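{- Let $G$ be a 2-connected graph and let $a,b,c,d,e\in V(G)$ be five distinct vertices with $\Gamma(a)=\{c,d\}$, $\Gamma(b)=\{c,e\}$, and $f:=\{d,e\}\in E(G)$. Then $f$ is redundant if and only if the graph $(G-c)-f$ is connected.
   Context: All graphs are finite, simple and undirected; "2-connected" means 2-vertex-connected. $\Gamma(v)$ denotes the set of neighbours of a vertex $v$. $G-c$ denotes deletion of vertex $c$ and its incident edges, $G-f$ deletion of edge $f$. For a 2-connected graph $G$, $\mathrm{OPT}(G)$ is the minimum number of edges of a 2-connected spanning subgraph of $G$. An edge $e$ of a 2-connected graph $G$ is called redundant if $G-e$ is 2-connected and $\mathrm{OPT}(G-e)=\mathrm{OPT}(G)$. -}

module Defs where

open import Data.Nat using (ℕ; zero; suc; _≤_)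
open import Data.Fin using (Fin)
open import Data.Fin.Properties using (_≟_; _<?_)
open import Data.Bool using (Bool; true; false; _∧_; _∨_; not; if_then_else_)
open import Data.Bool.Properties using (∧-comm; ∨-comm)
open import Data.List using (List; map; allFin)
open import Data.Nat.ListAction using (sum)
open import Data.Product using (Σ; _×_; _,_; ∃)
open import Data.Unit using (⊤)
open import Relation.Nullary using (¬_)
open import Relation.Nullary.Decidable using (⌊_⌋)
open import Relation.Binary.PropositionalEquality using (_≡_; _≢_; refl; cong₂; trans; cong)

record Graph (n : ℕ) : Set where
  field
    adj    : Fin n → Fin n → Bool
    sym    : ∀ u v → adj u v ≡ adj v u
    irrefl : ∀ u → adj u u ≡ false
open Graph public

isPair : ∀ {n} → Fin n → Fin n → Fin n → Fin n → Bool
isPair d e u v = (⌊ u ≟ d ⌋ ∧ ⌊ v ≟ e ⌋) ∨ (⌊ u ≟ e ⌋ ∧ ⌊ v ≟ d ⌋)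

private
  isPair-sym : ∀ {n} (d e u v : Fin n) → isPair d e u v ≡ isPair d e v u
  isPair-sym d e u v =
    trans (∨-comm (⌊ u ≟ d ⌋ ∧ ⌊ v ≟ e ⌋) (⌊ u ≟ e ⌋ ∧ ⌊ v ≟ d ⌋))
          (cong₂ _∨_ (∧-comm ⌊ u ≟ e ⌋ ⌊ v ≟ d ⌋) (∧-comm ⌊ u ≟ d ⌋ ⌊ v ≟ e ⌋))

_-edge_,_ : ∀ {n} → Graph n → Fin n → Fin n → Graph n
adj    (G -edge d , e) u v = adj G u v ∧ not (isPair d e u v)
sym    (G -edge d , e) u v = cong₂ (λ x y → x ∧ not y) (sym G u v) (isPair-sym d e u v)
irrefl (G -edge d , e) u rewrite irrefl G u = refl

-- Walks in G all of whose vertices satisfy the predicate S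
-- (S describes the vertex set of an induced subgraph, e.g. G - c).
data Walk {n} (G : Graph n) (S : Fin n → Set) : Fin n → Fin n → Set where
  stay : ∀ {u} → S u → Walk G S u u
  step : ∀ {u v w} → S u → adj G u v ≡ true → Walk G S v w → Walk G S u w

ConnectedOn : ∀ {n} → Graph n → (Fin n → Set) → Set
ConnectedOn {n} G S = ∀ (u v : Fin n) → S u → S v → Walk G S u v

Connected : ∀ {n} → Graph n → Set
Connected G = ConnectedOn G (λ _ → ⊤)

ConnectedWithout : ∀ {n} → Graph n → Fin n → Set
ConnectedWithout G c = ConnectedOn G (λ v → v ≢ c)

TwoConnected : ∀ {n} → Graph n → Set
TwoConnected {n} G = (3 ≤ n) × Connected G × (∀ (x : Fin n) → ConnectedWithout G x)

edgeCount : ∀ {n} → Graph n → ℕ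
edgeCount {n} G =
  sum (map (λ i → sum (map (λ j → if ⌊ i <? j ⌋ ∧ adj G i j then 1 else 0) (allFin n))) (allFin n))

SpanningSubgraph : ∀ {n} → Graph n → Graph n → Set
SpanningSubgraph {n} H G = ∀ (u v : Fin n) → adj H u v ≡ true → adj G u v ≡ true

IsOPT : ∀ {n} → Graph n → ℕ → Set
IsOPT {n} G k =
  (Σ (Graph n) λ H → SpanningSubgraph H G × TwoConnected H × edgeCount H ≡ k)
  × (∀ (H : Graph n) → SpanningSubgraph H G → TwoConnected H → k ≤ edgeCount H)

Redundant : ∀ {n} → Graph n → Fin n → Fin n → Set
Redundant G d e =
  TwoConnected (G -edge d , e) × ∃ λ k → IsOPT G k × IsOPT (G -edge d , e) k

module Submission where

-- Only-if is immediate: redundancy makes F 2-connected.  For the converse two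
-- facts are proved about the "gadget", the path d a c b e in which a and b
-- have degree 2.  (1) Structural lemma: a graph K ⊆ G containing the gadget,
-- with K - c connected and with all edges of some 2-connected B except f, is
-- 2-connected; for x ≠ c, d and e stay joined in K - x, so walks of B - x
-- reroute through K - x.  With B = G, K = F this makes F 2-connected.
-- (2) Exchange: every 2-connected spanning H ⊆ G contains the gadget and can be
-- replaced by a 2-connected spanning subgraph of F with at most as many edges:
-- H itself if f ∉ H; H - f if d, e are joined in (H - f) - c; otherwise H - f
-- plus an edge of F - c leaving the part of (H - f) - c reachable from d.
-- Hence OPT(F) = OPT(G).

open import Defs
open import Data.Nat using (ℕ)
open import Data.Fin using (Fin)
open import Data.Bool using (true)
open import Data.Sum using (_⊎_)
open import Function.Bundles using (_⇔_)
open import Relation.Binary.PropositionalEquality using (_≡_; _≢_)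

open import Data.Bool using (Bool; false; _∧_; _∨_; not; if_then_else_)
open import Data.Bool.Properties as Bool using (∧-comm; ∧-zeroʳ)
open import Data.Nat as ℕ using (zero; suc; _+_; _≤_)
import Data.Nat.Properties as ℕP
open import Algebra.Properties.CommutativeSemigroup ℕP.+-commutativeSemigroup
  using () renaming (interchange to +-interchange)
open import Data.Fin using (zero; suc)
open import Data.Fin.Properties using (_≟_; _<?_; <-cmp; <-asym; any?; all?)
open import Data.Fin.Subset using (Subset; _∈_; _-_; ⁅_⁆; ⊤; ∣_∣)
open import Data.Fin.Subset.Properties
  using (_∈?_; ∈⊤; ∣p∣≤n; p─q⊆p; x∈p∧x≢y⇒x∈p-y; x∈p⇒∣p-x∣<∣p∣)
open import Data.List using (List; []; _∷_; map; tabulate; allFin; filter; cartesianProductWith)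
open import Data.List.Membership.Propositional using () renaming (_∈_ to _∈ˡ_)
open import Data.List.Membership.Propositional.Properties using (∈-cartesianProductWith⁺; ∈-filter⁺)
open import Data.List.Relation.Unary.Any using (here; there)
import Data.List.Relation.Unary.All as All
open import Data.List.Relation.Unary.All.Properties using (all-filter)
open import Data.List.Extrema ℕP.≤-totalOrder using (argmin; argmin-all; f[argmin]≤f[xs])
open import Data.Nat.ListAction using (sum)
open import Data.Vec as V using (Vec; []; _∷_; lookup)
import Data.Vec.Properties as VP
open import Data.Product using (Σ; Σ-syntax; _×_; _,_; ∃; proj₁; proj₂)
open import Data.Sum using (inj₁; inj₂; swap; [_,_]′)
open import Data.Unit using (tt)
open import Data.Empty using (⊥-elim)
open import Function.Base using (id)
open import Function.Bundles using (mk⇔; Equivalence)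
open import Relation.Binary using (tri<; tri≈; tri>)
open import Relation.Nullary using (¬_; Dec; yes; no; does; _because_)
open import Relation.Nullary.Decidable
  using (isYes; ⌊_⌋; _×-dec_; _⊎-dec_; _→-dec_; ¬?; dec-true; dec-false; map′)
open import Relation.Binary.PropositionalEquality using (refl; trans; cong; cong₂; ≢-sym; module ≡-Reasoning)
  renaming (sym to ≡-sym)

witness : ∀ {A : Set} (a? : Dec A) → does a? ≡ true → A
witness (yes a) _ = a

true≢false : true ≢ false
true≢false ()

IsPair : ∀ {n} → Fin n → Fin n → Fin n → Fin n → Set
IsPair d e x y = (x ≡ d × y ≡ e) ⊎ (x ≡ e × y ≡ d)

isPair? : ∀ {n} (d e x y : Fin n) → Dec (IsPair d e x y)
isPair? d e x y = (x ≟ d ×-dec y ≟ e) ⊎-dec (x ≟ e ×-dec y ≟ d)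

isYes≡does : ∀ {A : Set} (a? : Dec A) → isYes a? ≡ does a?
isYes≡does (true because _) = refl
isYes≡does (false because _) = refl

isPair≡does : ∀ {n} (d e x y : Fin n) → isPair d e x y ≡ does (isPair? d e x y)
isPair≡does d e x y =
  cong₂ _∨_ (cong₂ _∧_ (isYes≡does (x ≟ d)) (isYes≡does (y ≟ e)))
            (cong₂ _∧_ (isYes≡does (x ≟ e)) (isYes≡does (y ≟ d)))

isPair⇒IsPair : ∀ {n} {d e x y : Fin n} → isPair d e x y ≡ true → IsPair d e x y
isPair⇒IsPair {d = d} {e} {x} {y} p = witness (isPair? d e x y) (trans (≡-sym (isPair≡does d e x y)) p)

IsPair⇒isPair : ∀ {n} {d e x y : Fin n} → IsPair d e x y → isPair d e x y ≡ true
IsPair⇒isPair {d = d} {e} {x} {y} p = trans (isPair≡does d e x y) (dec-true (isPair? d e x y) p)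

¬IsPair⇒isPair : ∀ {n} {d e x y : Fin n} → ¬ IsPair d e x y → isPair d e x y ≡ false
¬IsPair⇒isPair {d = d} {e} {x} {y} p = trans (isPair≡does d e x y) (dec-false (isPair? d e x y) p)

IsPair-swap : ∀ {n} {d e x y : Fin n} → IsPair d e x y → IsPair d e y x
IsPair-swap (inj₁ (refl , refl)) = inj₂ (refl , refl)
IsPair-swap (inj₂ (refl , refl)) = inj₁ (refl , refl)

IsPair-sym : ∀ {n} {d e x y : Fin n} → IsPair d e x y → IsPair x y d e
IsPair-sym (inj₁ (refl , refl)) = inj₁ (refl , refl)
IsPair-sym (inj₂ (refl , refl)) = inj₂ (refl , refl)

isPair-sym : ∀ {n} (d e x y : Fin n) → isPair d e x y ≡ isPair d e y x
isPair-sym d e x y with isPair? d e x y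
... | yes p = trans (IsPair⇒isPair p) (≡-sym (IsPair⇒isPair (IsPair-swap p)))
... | no ¬p = trans (¬IsPair⇒isPair ¬p) (≡-sym (¬IsPair⇒isPair (λ q → ¬p (IsPair-swap q))))

adj-sym : ∀ {n} (K : Graph n) {x y} → adj K x y ≡ true → adj K y x ≡ true
adj-sym K {x} {y} xy = trans (Graph.sym K y x) xy

pair-edge : ∀ {n} (K : Graph n) {d e x y} → adj K d e ≡ true → IsPair d e x y → adj K x y ≡ true
pair-edge K de (inj₁ (refl , refl)) = de
pair-edge K de (inj₂ (refl , refl)) = adj-sym K de

⊆-refl : ∀ {n} (K : Graph n) → SpanningSubgraph K K
⊆-refl K _ _ uv = uv

AllEdgesBut : ∀ {n} → Fin n → Fin n → Graph n → Graph n → Set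
AllEdgesBut d e K K' = ∀ {x y} → adj K x y ≡ true → adj K' x y ≡ true ⊎ IsPair d e x y

∧-not-true : ∀ {a b : Bool} → a ∧ not b ≡ true → a ≡ true × b ≡ false
∧-not-true {true} {false} _ = refl , refl

deleted-edge : ∀ {n} (K : Graph n) {d e x y} → adj (K -edge d , e) x y ≡ true →
  adj K x y ≡ true × ¬ IsPair d e x y
deleted-edge K xy with ∧-not-true xy
... | xy∈K , notPair = xy∈K , λ p → true≢false (trans (≡-sym (IsPair⇒isPair p)) notPair)

kept-edge : ∀ {n} (K : Graph n) {d e x y} → adj K x y ≡ true → ¬ IsPair d e x y →
  adj (K -edge d , e) x y ≡ true
kept-edge K xy notPair rewrite xy | ¬IsPair⇒isPair notPair = refl

-edge-⊆ : ∀ {n} (K : Graph n) (d e : Fin n) → SpanningSubgraph (K -edge d , e) K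
-edge-⊆ K d e x y xy = proj₁ (deleted-edge K xy)

-edge-allBut : ∀ {n} (K : Graph n) (d e : Fin n) → AllEdgesBut d e K (K -edge d , e)
-edge-allBut K d e {x} {y} xy with isPair? d e x y
... | yes p = inj₂ p
... | no ¬p = inj₁ (kept-edge K xy ¬p)

_+edge_,_[_] : ∀ {n} → Graph n → (u v : Fin n) → u ≢ v → Graph n
adj    (K +edge u , v [ u≢v ]) x y = adj K x y ∨ isPair u v x y
sym    (K +edge u , v [ u≢v ]) x y = cong₂ _∨_ (Graph.sym K x y) (isPair-sym u v x y)
irrefl (K +edge u , v [ u≢v ]) x rewrite irrefl K x = ¬IsPair⇒isPair loop
  where
  loop : ¬ IsPair u v x x
  loop (inj₁ (refl , refl)) = u≢v refl
  loop (inj₂ (refl , refl)) = u≢v refl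

+edge-⊇ : ∀ {n} (K : Graph n) {u v} (u≢v : u ≢ v) → SpanningSubgraph K (K +edge u , v [ u≢v ])
+edge-⊇ K u≢v x y xy rewrite xy = refl

+edge-new : ∀ {n} (K : Graph n) {u v} (u≢v : u ≢ v) → adj (K +edge u , v [ u≢v ]) u v ≡ true
+edge-new K {u} {v} u≢v rewrite IsPair⇒isPair {d = u} {v} {u} {v} (inj₁ (refl , refl)) = Bool.∨-zeroʳ _

+edge-edges : ∀ {n} (K : Graph n) {u v x y} (u≢v : u ≢ v) → adj (K +edge u , v [ u≢v ]) x y ≡ true →
  adj K x y ≡ true ⊎ IsPair u v x y
+edge-edges K {u} {v} {x} {y} u≢v xy with adj K x y
... | true = inj₁ refl
... | false = inj₂ (isPair⇒IsPair xy)

allBut-⊆ : ∀ {n} {d e : Fin n} {K K' K'' : Graph n} →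
  AllEdgesBut d e K K' → SpanningSubgraph K' K'' → AllEdgesBut d e K K''
allBut-⊆ K⊆K'+de K'⊆K'' xy with K⊆K'+de xy
... | inj₁ xy' = inj₁ (K'⊆K'' _ _ xy')
... | inj₂ p = inj₂ p

_∖_ : ∀ {n} → (Fin n → Set) → Fin n → Fin n → Set
(S ∖ x) z = S z × z ≢ x

module _ {n} {K : Graph n} {S : Fin n → Set} where

  walk-head : ∀ {u v} → Walk K S u v → S u
  walk-head (stay s) = s
  walk-head (step s _ _) = s

  _++ʷ_ : ∀ {u v w} → Walk K S u v → Walk K S v w → Walk K S u w
  stay _ ++ʷ W' = W'
  step s a W ++ʷ W' = step s a (W ++ʷ W')

  edge-walk : ∀ {u v} → S u → S v → adj K u v ≡ true → Walk K S u v
  edge-walk su sv uv = step su uv (stay sv)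

  reverse : ∀ {u v} → Walk K S u v → Walk K S v u
  reverse (stay s) = stay s
  reverse (step s uw W) = reverse W ++ʷ edge-walk (walk-head W) s (adj-sym K uw)

  first-step : ∀ {u v} → Walk K S u v → u ≢ v → ∃ λ w → adj K u w ≡ true × S w
  first-step (stay _) u≢u = ⊥-elim (u≢u refl)
  first-step (step _ uw W) _ = _ , uw , walk-head W

  last-visit : ∀ x {u v} → Walk K S u v → v ≢ x →
    Walk K (S ∖ x) u v ⊎ (∃ λ w → adj K x w ≡ true × Walk K (S ∖ x) w v)
  last-visit x (stay s) v≢x = inj₁ (stay (s , v≢x))
  last-visit x (step {u = u} s uw W) v≢x with last-visit x W v≢x
  ... | inj₂ tail = inj₂ tail
  ... | inj₁ W' with u ≟ x
  ...   | yes refl = inj₂ (_ , uw , W')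
  ...   | no u≢x = inj₁ (step (s , u≢x) uw W')

  exit-edge : (P : Fin n → Set) → (∀ x → Dec (P x)) → ∀ {u v} → Walk K S u v → P u → ¬ P v →
    Σ[ x ∈ Fin n ] Σ[ y ∈ Fin n ] S x × S y × adj K x y ≡ true × P x × ¬ P y
  exit-edge P P? (stay _) pu ¬pv = ⊥-elim (¬pv pu)
  exit-edge P P? (step {v = w} s uw W) pu ¬pv with P? w
  ... | yes pw = exit-edge P P? W pw ¬pv
  ... | no ¬pw = _ , w , s , walk-head W , uw , pu , ¬pw

  until-edge : ∀ d e {u v} → Walk K S u v →
    Walk (K -edge d , e) S u v ⊎ Walk (K -edge d , e) S u d ⊎ Walk (K -edge d , e) S u e
  until-edge d e (stay s) = inj₁ (stay s)
  until-edge d e (step {u = u} {v = w} s uw W) with isPair? d e u w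
  ... | yes (inj₁ (refl , _)) = inj₂ (inj₁ (stay s))
  ... | yes (inj₂ (refl , _)) = inj₂ (inj₂ (stay s))
  ... | no ¬p with until-edge d e W
  ...   | inj₁ W' = inj₁ (step s (kept-edge K uw ¬p) W')
  ...   | inj₂ (inj₁ W') = inj₂ (inj₁ (step s (kept-edge K uw ¬p) W'))
  ...   | inj₂ (inj₂ W') = inj₂ (inj₂ (step s (kept-edge K uw ¬p) W'))

map-walk : ∀ {n} {K K' : Graph n} {S S' : Fin n → Set} →
  (∀ {x} → S x → S' x) → SpanningSubgraph K K' → ∀ {u v} → Walk K S u v → Walk K' S' u v
map-walk f K⊆K' (stay s) = stay (f s)
map-walk f K⊆K' (step s uw W) = step (f s) (K⊆K' _ _ uw) (map-walk f K⊆K' W)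

bypass : ∀ {n} {K : Graph n} {S : Fin n → Set} {x y u v} →
  (∀ {w} → adj K x w ≡ true → S w → w ≡ y) → v ≢ x → Walk K S u v →
  Walk K (S ∖ x) u v ⊎ Walk K (S ∖ x) y v
bypass {x = x} only-y v≢x W with last-visit x W v≢x
... | inj₁ W' = inj₁ W'
... | inj₂ (w , xw , W') with only-y xw (proj₁ (walk-head W'))
...   | refl = inj₂ W'

avoid-degree-two : ∀ {n} {K : Graph n} {c x u v : Fin n} → (∀ {w} → adj K x w ≡ true → w ≡ c ⊎ w ≡ u) →
  v ≢ x → Walk K (λ z → z ≢ c) u v → Walk K (λ z → z ≢ x) u v
avoid-degree-two {K = K} {c} {x} {u} Γx⊆cu v≢x W = [ forget-c , forget-c ]′ (bypass only-u v≢x W)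
  where
  only-u : ∀ {w} → adj K x w ≡ true → w ≢ c → w ≡ u
  only-u xw w≢c with Γx⊆cu xw
  ... | inj₁ w≡c = ⊥-elim (w≢c w≡c)
  ... | inj₂ w≡u = w≡u
  forget-c : ∀ {s t} → Walk K ((λ z → z ≢ c) ∖ x) s t → Walk K (λ z → z ≢ x) s t
  forget-c = map-walk proj₂ (⊆-refl K)

reroute : ∀ {n} {K K' : Graph n} {S : Fin n → Set} {d e : Fin n} →
  AllEdgesBut d e K K' → (S d → S e → Walk K' S d e) →
  ∀ {u v} → Walk K S u v → Walk K' S u v
reroute K⊆K'+de bridge (stay s) = stay s
reroute {K = K} {K'} {S} K⊆K'+de bridge (step s uw W) =
  first-edge uw s (walk-head W) ++ʷ reroute K⊆K'+de bridge W
  where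
  first-edge : ∀ {x y} → adj K x y ≡ true → S x → S y → Walk K' S x y
  first-edge xy sx sy with K⊆K'+de xy
  ... | inj₁ xy' = edge-walk sx sy xy'
  ... | inj₂ (inj₁ (refl , refl)) = bridge sx sy
  ... | inj₂ (inj₂ (refl , refl)) = reverse (bridge sy sx)

reroute-connected : ∀ {n} {K K' : Graph n} {S : Fin n → Set} {d e : Fin n} →
  AllEdgesBut d e K K' → (S d → S e → Walk K' S d e) → ConnectedOn K S → ConnectedOn K' S
reroute-connected K⊆K'+de bridge conn u v su sv = reroute K⊆K'+de bridge (conn u v su sv)

twoConnected-mono : ∀ {n} {K K' : Graph n} → SpanningSubgraph K K' → TwoConnected K → TwoConnected K'
twoConnected-mono K⊆K' (3≤n , conn , conn-x) =
  3≤n , (λ u v su sv → map-walk id K⊆K' (conn u v su sv))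
      , (λ x u v su sv → map-walk id K⊆K' (conn-x x u v su sv))

module _ {n} (K : Graph n) {S : Fin n → Set} (S? : ∀ x → Dec (S x)) where

  -- Walks inside S ∩ p are decided by recursion on ∣ p ∣: a walk from u to
  -- v ≢ u may be assumed to leave u for good after its first step, so it is
  -- an edge u w followed by a walk inside S ∩ (p - u).
  private
    walk-within? : ∀ m (p : Subset n) → ∣ p ∣ ≤ m → ∀ u v → Dec (Walk K (λ z → S z × z ∈ p) u v)
    walk-within? zero p ∣p∣≤0 u v = no λ W →
      ℕP.n≮0 (ℕP.<-≤-trans (x∈p⇒∣p-x∣<∣p∣ (proj₂ (walk-head W))) ∣p∣≤0)
    walk-within? (suc m) p ∣p∣≤1+m u v with S? u ×-dec u ∈? p
    ... | no ¬ok = no λ W → ¬ok (walk-head W)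
    ... | yes ok with u ≟ v
    ...   | yes refl = yes (stay ok)
    ...   | no u≢v = map′ leave-u return-u onward?
      where
      ∣p-u∣≤m : ∣ p - u ∣ ≤ m
      ∣p-u∣≤m = ℕP.≤-pred (ℕP.<-≤-trans (x∈p⇒∣p-x∣<∣p∣ (proj₂ ok)) ∣p∣≤1+m)
      onward? : Dec (∃ λ w → adj K u w ≡ true × Walk K (λ z → S z × z ∈ p - u) w v)
      onward? = any? λ w → (adj K u w Bool.≟ true) ×-dec walk-within? m (p - u) ∣p-u∣≤m w v
      leave-u : (∃ λ w → adj K u w ≡ true × Walk K (λ z → S z × z ∈ p - u) w v) →
        Walk K (λ z → S z × z ∈ p) u v
      leave-u (w , uw , W) =
        step ok uw (map-walk (λ { (s , z∈p-u) → s , p─q⊆p p ⁅ u ⁆ z∈p-u }) (⊆-refl K) W)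
      return-u : Walk K (λ z → S z × z ∈ p) u v →
        ∃ λ w → adj K u w ≡ true × Walk K (λ z → S z × z ∈ p - u) w v
      return-u W with last-visit u W (≢-sym u≢v)
      ... | inj₁ W' = ⊥-elim (proj₂ (walk-head W') refl)
      ... | inj₂ (w , uw , W') =
        w , uw , map-walk (λ { ((s , z∈p) , z≢u) → s , x∈p∧x≢y⇒x∈p-y z∈p z≢u }) (⊆-refl K) W'

  walk? : ∀ u v → Dec (Walk K S u v)
  walk? u v = map′ (map-walk proj₁ (⊆-refl K)) (map-walk (λ s → s , ∈⊤) (⊆-refl K))
                   (walk-within? n ⊤ (∣p∣≤n ⊤) u v)

  connectedOn? : Dec (ConnectedOn K S)
  connectedOn? = all? λ u → all? λ v → S? u →-dec S? v →-dec walk? u v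

twoConnected? : ∀ {n} (K : Graph n) → Dec (TwoConnected K)
twoConnected? {n} K = (3 ℕ.≤? n) ×-dec connectedOn? K (λ _ → yes tt)
                               ×-dec all? (λ x → connectedOn? K (λ v → ¬? (v ≟ x)))

∑ : ∀ {n} → (Fin n → ℕ) → ℕ
∑ {zero} f = 0
∑ {suc n} f = f zero + ∑ (λ i → f (suc i))

∑-cong : ∀ {n} {f g : Fin n → ℕ} → (∀ i → f i ≡ g i) → ∑ f ≡ ∑ g
∑-cong {zero} f≗g = refl
∑-cong {suc n} f≗g = cong₂ _+_ (f≗g zero) (∑-cong (λ i → f≗g (suc i)))

∑-mono : ∀ {n} {f g : Fin n → ℕ} → (∀ i → f i ≤ g i) → ∑ f ≤ ∑ g
∑-mono {zero} f≤g = ℕ.z≤n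
∑-mono {suc n} f≤g = ℕP.+-mono-≤ (f≤g zero) (∑-mono (λ i → f≤g (suc i)))

∑-+ : ∀ {n} (f g : Fin n → ℕ) → ∑ (λ i → f i + g i) ≡ ∑ f + ∑ g
∑-+ {zero} f g = refl
∑-+ {suc n} f g = begin
  (f zero + g zero) + ∑ (λ i → f (suc i) + g (suc i))
    ≡⟨ cong (f zero + g zero +_) (∑-+ (λ i → f (suc i)) (λ i → g (suc i))) ⟩
  (f zero + g zero) + (∑ (λ i → f (suc i)) + ∑ (λ i → g (suc i)))
    ≡⟨ +-interchange (f zero) (g zero) _ _ ⟩
  (f zero + ∑ (λ i → f (suc i))) + (g zero + ∑ (λ i → g (suc i)))   ∎
  where open ≡-Reasoning

∑-zero : ∀ {n} → ∑ {n} (λ _ → 0) ≡ 0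
∑-zero {zero} = refl
∑-zero {suc n} = ∑-zero {n}

∑-if : ∀ {n} (b : Bool) (f : Fin n → ℕ) → ∑ (λ i → if b then f i else 0) ≡ (if b then ∑ f else 0)
∑-if true f = refl
∑-if {n} false f = ∑-zero {n}

∑-point : ∀ {n} (p : Fin n) (f : Fin n → ℕ) → ∑ (λ i → if does (i ≟ p) then f i else 0) ≡ f p
∑-point {suc n} zero f = trans (cong (f zero +_) (∑-zero {n})) (ℕP.+-identityʳ (f zero))
∑-point {suc n} (suc p) f = ∑-point p (λ i → f (suc i))

sum-tabulate : ∀ {n} {A : Set} (f : A → ℕ) (g : Fin n → A) → sum (map f (tabulate g)) ≡ ∑ (λ i → f (g i))
sum-tabulate {zero} f g = refl
sum-tabulate {suc n} f g = cong (f (g zero) +_) (sum-tabulate f (λ i → g (suc i)))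

∑² : ∀ {n} → (Fin n → Fin n → ℕ) → ℕ
∑² f = ∑ λ i → ∑ λ j → f i j

∑²-cong : ∀ {n} {f g : Fin n → Fin n → ℕ} → (∀ i j → f i j ≡ g i j) → ∑² f ≡ ∑² g
∑²-cong f≗g = ∑-cong λ i → ∑-cong (f≗g i)

∑²-mono : ∀ {n} {f g : Fin n → Fin n → ℕ} → (∀ i j → f i j ≤ g i j) → ∑² f ≤ ∑² g
∑²-mono f≤g = ∑-mono λ i → ∑-mono (f≤g i)

∑²-+ : ∀ {n} (f g : Fin n → Fin n → ℕ) → ∑² (λ i j → f i j + g i j) ≡ ∑² f + ∑² g
∑²-+ f g = trans (∑-cong λ i → ∑-+ (f i) (g i)) (∑-+ (λ i → ∑ (f i)) (λ i → ∑ (g i)))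

ind : Bool → ℕ
ind b = if b then 1 else 0

pairTerm : ∀ {n} → (Fin n → Fin n → Bool) → Fin n → Fin n → ℕ
pairTerm E i j = ind (⌊ i <? j ⌋ ∧ E i j)

pairCount : ∀ {n} → (Fin n → Fin n → Bool) → ℕ
pairCount E = ∑² (pairTerm E)

edgeCount≡pairCount : ∀ {n} (K : Graph n) → edgeCount K ≡ pairCount (adj K)
edgeCount≡pairCount {n} K =
  trans (sum-tabulate (λ i → sum (map (λ j → ind (⌊ i <? j ⌋ ∧ adj K i j)) (allFin n))) (λ i → i))
        (∑-cong λ i → sum-tabulate (λ j → ind (⌊ i <? j ⌋ ∧ adj K i j)) (λ j → j))

pairCount-cong : ∀ {n} {E E' : Fin n → Fin n → Bool} → (∀ i j → E i j ≡ E' i j) →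
  pairCount E ≡ pairCount E'
pairCount-cong E≗E' = ∑²-cong λ i j → cong (λ b → ind (⌊ i <? j ⌋ ∧ b)) (E≗E' i j)

pairCount-mono : ∀ {n} {E E' : Fin n → Fin n → Bool} → (∀ i j → E i j ≡ true → E' i j ≡ true) →
  pairCount E ≤ pairCount E'
pairCount-mono E⊆E' = ∑²-mono λ i j → ind-mono ⌊ i <? j ⌋ (E⊆E' i j)
  where
  ind-mono : ∀ l {a b} → (a ≡ true → b ≡ true) → ind (l ∧ a) ≤ ind (l ∧ b)
  ind-mono false _ = ℕ.z≤n
  ind-mono true {false} _ = ℕ.z≤n
  ind-mono true {true} a⇒b rewrite a⇒b refl = ℕP.≤-refl

pairCount-∨ : ∀ {n} (E E' : Fin n → Fin n → Bool) →
  pairCount (λ i j → E i j ∨ E' i j) ≤ pairCount E + pairCount E'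
pairCount-∨ E E' = ℕP.≤-trans (∑²-mono λ i j → ind-∨ ⌊ i <? j ⌋ (E i j) (E' i j))
                              (ℕP.≤-reflexive (∑²-+ (pairTerm E) (pairTerm E')))
  where
  ind-∨ : ∀ l a b → ind (l ∧ (a ∨ b)) ≤ ind (l ∧ a) + ind (l ∧ b)
  ind-∨ false a b = ℕ.z≤n
  ind-∨ true false b = ℕP.≤-refl
  ind-∨ true true b = ℕ.s≤s ℕ.z≤n

pairCount-disjoint : ∀ {n} (E E' : Fin n → Fin n → Bool) → (∀ i j → E i j ≡ true → E' i j ≡ false) →
  pairCount (λ i j → E i j ∨ E' i j) ≡ pairCount E + pairCount E'
pairCount-disjoint E E' disjoint =
  trans (∑²-cong λ i j → ind-∨ ⌊ i <? j ⌋ (E i j) (E' i j) (disjoint i j)) (∑²-+ (pairTerm E) (pairTerm E'))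
  where
  ind-∨ : ∀ l a b → (a ≡ true → b ≡ false) → ind (l ∧ (a ∨ b)) ≡ ind (l ∧ a) + ind (l ∧ b)
  ind-∨ false a b _ = refl
  ind-∨ true false b _ = refl
  ind-∨ true true b a⇒¬b rewrite a⇒¬b refl = refl

one-first : ∀ {n} {p q : Fin n} → p ≢ q → ind ⌊ p <? q ⌋ + ind ⌊ q <? p ⌋ ≡ 1
one-first {p = p} {q} p≢q with p <? q | q <? p
... | yes p<q | yes q<p = ⊥-elim (<-asym p<q q<p)
... | yes _ | no _ = refl
... | no _ | yes _ = refl
... | no p≮q | no q≮p with <-cmp p q
...   | tri< p<q _ _ = ⊥-elim (p≮q p<q)
...   | tri≈ _ p≡q _ = ⊥-elim (p≢q p≡q)
...   | tri> _ _ q<p = ⊥-elim (q≮p q<p)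

at : ∀ {n} → Fin n → Fin n → Fin n → Fin n → Bool
at p q i j = does (i ≟ p) ∧ does (j ≟ q)

pairCount-at : ∀ {n} (p q : Fin n) → pairCount (at p q) ≡ ind ⌊ p <? q ⌋
pairCount-at p q = begin
  ∑² (pairTerm (at p q))
    ≡⟨ ∑²-cong (λ i j → ind-∧∧ ⌊ i <? j ⌋ (does (i ≟ p)) (does (j ≟ q))) ⟩
  ∑ (λ i → ∑ λ j → if does (i ≟ p) then (if does (j ≟ q) then ind ⌊ i <? j ⌋ else 0) else 0)
    ≡⟨ ∑-cong (λ i → ∑-if (does (i ≟ p)) (λ j → if does (j ≟ q) then ind ⌊ i <? j ⌋ else 0)) ⟩
  ∑ (λ i → if does (i ≟ p) then ∑ (λ j → if does (j ≟ q) then ind ⌊ i <? j ⌋ else 0) else 0)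
    ≡⟨ ∑-point p (λ i → ∑ (λ j → if does (j ≟ q) then ind ⌊ i <? j ⌋ else 0)) ⟩
  ∑ (λ j → if does (j ≟ q) then ind ⌊ p <? j ⌋ else 0)
    ≡⟨ ∑-point q (λ j → ind ⌊ p <? j ⌋) ⟩
  ind ⌊ p <? q ⌋ ∎
  where
  open ≡-Reasoning
  ind-∧∧ : ∀ l x y → ind (l ∧ (x ∧ y)) ≡ (if x then (if y then ind l else 0) else 0)
  ind-∧∧ l true true = cong ind (Bool.∧-identityʳ l)
  ind-∧∧ l true false = cong ind (∧-zeroʳ l)
  ind-∧∧ l false y = cong ind (∧-zeroʳ l)

pairCount-pair : ∀ {n} {p q : Fin n} → p ≢ q → pairCount (isPair p q) ≡ 1
pairCount-pair {p = p} {q} p≢q = begin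
  pairCount (isPair p q)                        ≡⟨ pairCount-cong (isPair≡does p q) ⟩
  pairCount (λ i j → at p q i j ∨ at q p i j)   ≡⟨ pairCount-disjoint (at p q) (at q p) not-both ⟩
  pairCount (at p q) + pairCount (at q p)       ≡⟨ cong₂ _+_ (pairCount-at p q) (pairCount-at q p) ⟩
  ind ⌊ p <? q ⌋ + ind ⌊ q <? p ⌋               ≡⟨ one-first p≢q ⟩
  1                                              ∎
  where
  open ≡-Reasoning
  not-both : ∀ i j → at p q i j ≡ true → at q p i j ≡ false
  not-both i j ij=pq with i ≟ p | i ≟ q
  ... | yes refl | yes refl = ⊥-elim (p≢q refl)
  ... | yes refl | no _ = refl
  not-both i j () | no _ | _

edgeCount-mono : ∀ {n} {K K' : Graph n} → SpanningSubgraph K K' → edgeCount K ≤ edgeCount K'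
edgeCount-mono {K = K} {K'} K⊆K' = begin
  edgeCount K        ≡⟨ edgeCount≡pairCount K ⟩
  pairCount (adj K)  ≤⟨ pairCount-mono K⊆K' ⟩
  pairCount (adj K') ≡⟨ edgeCount≡pairCount K' ⟨
  edgeCount K'       ∎
  where open ℕP.≤-Reasoning

-- Exchanging an edge {d , e} of K for a pair {u , v} does not increase the
-- number of edges: the new pair counts at most one, the old edge exactly one.
edgeCount-exchange : ∀ {n} (K : Graph n) {d e u v : Fin n} → adj K d e ≡ true → d ≢ e → (u≢v : u ≢ v) →
  edgeCount ((K -edge d , e) +edge u , v [ u≢v ]) ≤ edgeCount K
edgeCount-exchange K {d} {e} {u} {v} de∈K d≢e u≢v = begin
  edgeCount (K' +edge u , v [ u≢v ])                   ≡⟨ edgeCount≡pairCount (K' +edge u , v [ u≢v ]) ⟩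
  pairCount (λ i j → adj K' i j ∨ isPair u v i j)      ≤⟨ pairCount-∨ (adj K') (isPair u v) ⟩
  pairCount (adj K') + pairCount (isPair u v)          ≡⟨ cong (pairCount (adj K') +_) (pairCount-pair u≢v) ⟩
  pairCount (adj K') + 1                               ≡⟨ cong (pairCount (adj K') +_) (pairCount-pair d≢e) ⟨
  pairCount (adj K') + pairCount (isPair d e)          ≡⟨ pairCount-disjoint (adj K') (isPair d e) deleted ⟨
  pairCount (λ i j → adj K' i j ∨ isPair d e i j)      ≤⟨ pairCount-mono within-K ⟩
  pairCount (adj K)                                    ≡⟨ edgeCount≡pairCount K ⟨
  edgeCount K                                          ∎
  where
  open ℕP.≤-Reasoning
  K' : Graph _
  K' = K -edge d , e
  deleted : ∀ i j → adj K' i j ≡ true → isPair d e i j ≡ false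
  deleted i j ij∈K' = ¬IsPair⇒isPair (proj₂ (deleted-edge K ij∈K'))
  within-K : ∀ i j → adj K' i j ∨ isPair d e i j ≡ true → adj K i j ≡ true
  within-K i j ij with adj K' i j in ij∈K'
  ... | true = -edge-⊆ K d e i j ij∈K'
  ... | false = pair-edge K de∈K (isPair⇒IsPair ij)

-- Boolean matrices select spanning subgraphs of G: M keeps the edge {u , v}
-- of G when M u v and M v u.  There are finitely many matrices, so a
-- 2-connected spanning subgraph of least size can be found by exhaustion.
Matrix : ℕ → Set
Matrix n = Vec (Vec Bool n) n

select : ∀ {n} → Graph n → Matrix n → Graph n
adj    (select G M) u v = (lookup (lookup M u) v ∧ lookup (lookup M v) u) ∧ adj G u v
sym    (select G M) u v = cong₂ _∧_ (∧-comm (lookup (lookup M u) v) _) (Graph.sym G u v)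
irrefl (select G M) u = trans (cong (_ ∧_) (irrefl G u)) (∧-zeroʳ _)

select-⊆ : ∀ {n} (G : Graph n) (M : Matrix n) → SpanningSubgraph (select G M) G
select-⊆ G M u v uv = proj₂ (∧-true uv)
  where
  ∧-true : ∀ {a b} → a ∧ b ≡ true → a ≡ true × b ≡ true
  ∧-true {true} {true} _ = refl , refl

matrixOf : ∀ {n} → Graph n → Matrix n
matrixOf H = V.tabulate λ u → V.tabulate λ v → adj H u v

select-matrixOf : ∀ {n} {G H : Graph n} → SpanningSubgraph H G → ∀ u v →
  adj (select G (matrixOf H)) u v ≡ adj H u v
select-matrixOf {G = G} {H} H⊆G u v
  rewrite VP.lookup∘tabulate (λ u → V.tabulate λ v → adj H u v) u
        | VP.lookup∘tabulate (λ u → V.tabulate λ v → adj H u v) v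
        | VP.lookup∘tabulate (λ v → adj H u v) v
        | VP.lookup∘tabulate (λ u → adj H v u) u
  with adj H u v in uv∈H
... | false = refl
... | true rewrite adj-sym H uv∈H | H⊆G u v uv∈H = refl

vectors : ∀ {A : Set} → List A → ∀ m → List (Vec A m)
vectors xs zero = [] ∷ []
vectors xs (suc m) = cartesianProductWith _∷_ xs (vectors xs m)

∈-vectors : ∀ {A : Set} {xs : List A} → (∀ x → x ∈ˡ xs) → ∀ {m} (v : Vec A m) → v ∈ˡ vectors xs m
∈-vectors every [] = here refl
∈-vectors every (x ∷ v) = ∈-cartesianProductWith⁺ _∷_ (every x) (∈-vectors every v)

matrices : ∀ n → List (Matrix n)
matrices n = vectors (vectors (true ∷ false ∷ []) n) n

∈-matrices : ∀ {n} (M : Matrix n) → M ∈ˡ matrices n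
∈-matrices M = ∈-vectors (∈-vectors every-bool) M
  where
  every-bool : ∀ b → b ∈ˡ true ∷ false ∷ []
  every-bool true = here refl
  every-bool false = there (here refl)

-- Among the finitely many matrices selecting a 2-connected subgraph, one of
-- least size exists (argmin, started at the matrix of G itself); every
-- 2-connected spanning subgraph H is selected by its own matrix.
optimum-exists : ∀ {n} (G : Graph n) → TwoConnected G → ∃ λ k → IsOPT G k
optimum-exists {n} G tcG = size best , (select G best , select-⊆ G best , best-tc , refl) , best-minimal
  where
  size : Matrix n → ℕ
  size M = edgeCount (select G M)
  Candidate : Matrix n → Set
  Candidate M = TwoConnected (select G M)
  candidate? : ∀ M → Dec (Candidate M)
  candidate? M = twoConnected? (select G M)
  candidates : List (Matrix n)
  candidates = filter candidate? (matrices n)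
  best : Matrix n
  best = argmin size (matrixOf G) candidates
  own-matrix-⊇ : ∀ H → SpanningSubgraph H G → SpanningSubgraph H (select G (matrixOf H))
  own-matrix-⊇ H H⊆G u v uv = trans (select-matrixOf {G = G} {H} H⊆G u v) uv
  own-matrix-⊆ : ∀ H → SpanningSubgraph H G → SpanningSubgraph (select G (matrixOf H)) H
  own-matrix-⊆ H H⊆G u v uv = trans (≡-sym (select-matrixOf {G = G} {H} H⊆G u v)) uv
  as-candidate : ∀ {H} → SpanningSubgraph H G → TwoConnected H → Candidate (matrixOf H)
  as-candidate {H} H⊆G = twoConnected-mono {K = H} (own-matrix-⊇ H H⊆G)
  best-tc : Candidate best
  best-tc = argmin-all size (as-candidate (⊆-refl G) tcG) (all-filter candidate? (matrices n))
  best-minimal : ∀ H → SpanningSubgraph H G → TwoConnected H → size best ≤ edgeCount H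
  best-minimal H H⊆G tcH = begin
    size best          ≤⟨ All.lookup (f[argmin]≤f[xs] {f = size} (matrixOf G) candidates)
                            (∈-filter⁺ candidate? (∈-matrices (matrixOf H)) (as-candidate H⊆G tcH)) ⟩
    size (matrixOf H)  ≤⟨ edgeCount-mono {K = select G (matrixOf H)} {H} (own-matrix-⊆ H H⊆G) ⟩
    edgeCount H        ∎
    where open ℕP.≤-Reasoning

Improvement : ∀ {n} → Graph n → Graph n → Set
Improvement {n} F H = Σ[ H' ∈ Graph n ] SpanningSubgraph H' F × TwoConnected H' × edgeCount H' ≤ edgeCount H

optimum-transfer : ∀ {n} {F G : Graph n} {k} → SpanningSubgraph F G →
  (∀ H → SpanningSubgraph H G → TwoConnected H → Improvement F H) → IsOPT G k → IsOPT F k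
optimum-transfer {F = F} {G} {k} F⊆G improve ((H , H⊆G , tcH , ∣H∣≡k) , G-minimal)
  with improve H H⊆G tcH
... | H' , H'⊆F , tcH' , ∣H'∣≤∣H∣ =
  (H' , H'⊆F , tcH' , ℕP.≤-antisym (ℕP.≤-trans ∣H'∣≤∣H∣ (ℕP.≤-reflexive ∣H∣≡k))
                                    (G-minimal H' (into-G {H'} H'⊆F) tcH')) ,
  λ H'' H''⊆F tcH'' → G-minimal H'' (into-G {H''} H''⊆F) tcH''
  where
  into-G : ∀ {K} → SpanningSubgraph K F → SpanningSubgraph K G
  into-G K⊆F u v uv = F⊆G u v (K⊆F u v uv)

forced-edge : ∀ {n} {G H : Graph n} {x p q z : Fin n} → SpanningSubgraph H G →
  (∀ {w} → adj G x w ≡ true → w ≡ p ⊎ w ≡ q) → Walk H (λ v → v ≢ p) x z → x ≢ z →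
  adj H x q ≡ true
forced-edge H⊆G Γx⊆pq W x≢z with first-step W x≢z
... | w , xw , w≢p with Γx⊆pq (H⊆G _ _ xw)
...   | inj₁ refl = ⊥-elim (w≢p refl)
...   | inj₂ refl = xw

module Configuration {n} (G : Graph n) (a b c d e : Fin n)
  (a≢b : a ≢ b) (a≢c : a ≢ c) (a≢d : a ≢ d) (a≢e : a ≢ e)
  (b≢c : b ≢ c) (b≢d : b ≢ d) (b≢e : b ≢ e) (c≢d : c ≢ d) (c≢e : c ≢ e) (d≢e : d ≢ e)
  (Γa : ∀ (v : Fin n) → (adj G a v ≡ true) ⇔ (v ≡ c ⊎ v ≡ d))
  (Γb : ∀ (v : Fin n) → (adj G b v ≡ true) ⇔ (v ≡ c ⊎ v ≡ e)) where

  F : Graph n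
  F = G -edge d , e

  record Gadget (K : Graph n) : Set where
    field
      ⊆G : SpanningSubgraph K G
      ac : adj K a c ≡ true
      ad : adj K a d ≡ true
      bc : adj K b c ≡ true
      be : adj K b e ≡ true

    Γa⊆cd : ∀ {w} → adj K a w ≡ true → w ≡ c ⊎ w ≡ d
    Γa⊆cd {w} aw = Equivalence.to (Γa w) (⊆G _ _ aw)

    Γb⊆ce : ∀ {w} → adj K b w ≡ true → w ≡ c ⊎ w ≡ e
    Γb⊆ce {w} bw = Equivalence.to (Γb w) (⊆G _ _ bw)

    path : (S : Fin n → Set) → S d → S a → S c → S b → S e → Walk K S d e
    path S sd sa sc sb se = step sd (adj-sym K ad) (step sa ac (step sc (adj-sym K bc) (edge-walk sb se be)))

  gadget-G : Gadget G
  gadget-G = record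
    { ⊆G = ⊆-refl G
    ; ac = Equivalence.from (Γa c) (inj₁ refl) ; ad = Equivalence.from (Γa d) (inj₂ refl)
    ; bc = Equivalence.from (Γb c) (inj₁ refl) ; be = Equivalence.from (Γb e) (inj₂ refl) }

  gadget-minus : ∀ {K} → Gadget K → Gadget (K -edge d , e)
  gadget-minus {K} gK = record
    { ⊆G = λ u v uv → ⊆G u v (-edge-⊆ K d e u v uv)
    ; ac = kept-edge K ac (off a≢d a≢e) ; ad = kept-edge K ad (off a≢d a≢e)
    ; bc = kept-edge K bc (off b≢d b≢e) ; be = kept-edge K be (off b≢d b≢e) }
    where
    open Gadget gK
    off : ∀ {x w} → x ≢ d → x ≢ e → ¬ IsPair d e x w
    off x≢d x≢e (inj₁ (x≡d , _)) = x≢d x≡d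
    off x≢d x≢e (inj₂ (x≡e , _)) = x≢e x≡e

  gadget-plus : ∀ {K K'} → Gadget K → SpanningSubgraph K K' → SpanningSubgraph K' G → Gadget K'
  gadget-plus gK K⊆K' K'⊆G = record
    { ⊆G = K'⊆G ; ac = K⊆K' _ _ ac ; ad = K⊆K' _ _ ad ; bc = K⊆K' _ _ bc ; be = K⊆K' _ _ be }
    where open Gadget gK

  -- Every 2-connected spanning subgraph of G contains the gadget: a vertex
  -- of degree ≤ 1 would be cut off by deleting its neighbour.
  gadget-forced : ∀ {H} → SpanningSubgraph H G → TwoConnected H → Gadget H
  gadget-forced H⊆G (_ , _ , conn-x) = record
    { ⊆G = H⊆G
    ; ac = forced-edge {G = G} H⊆G (λ aw → swap (Equivalence.to (Γa _) aw)) (conn-x d a b a≢d b≢d) a≢b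
    ; ad = forced-edge {G = G} H⊆G (λ aw → Equivalence.to (Γa _) aw) (conn-x c a b a≢c b≢c) a≢b
    ; bc = forced-edge {G = G} H⊆G (λ bw → swap (Equivalence.to (Γb _) bw)) (conn-x e b a b≢e a≢e) (≢-sym a≢b)
    ; be = forced-edge {G = G} H⊆G (λ bw → Equivalence.to (Γb _) bw) (conn-x c b a b≢c a≢c) (≢-sym a≢b) }

  -- If K contains the gadget, K - c is connected, and
  -- K has every edge of a 2-connected B except possibly {d , e}, then K is
  -- 2-connected: for x ≢ c the vertices d and e stay joined in K - x (around
  -- a, around b, or along the gadget path), so walks of B - x reroute into K - x.
  twoConnected-transfer : ∀ {B K} → TwoConnected B → AllEdgesBut d e B K → Gadget K →
    ConnectedWithout K c → TwoConnected K
  twoConnected-transfer {B} {K} (3≤n , connB , connB-x) B⊆K+de gK connK-c =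
    3≤n , reroute-connected B⊆K+de (λ _ _ → path _ tt tt tt tt tt) connB , connK-x
    where
    open Gadget gK
    joined-without : ∀ x → x ≢ c → d ≢ x → e ≢ x → Walk K (λ v → v ≢ x) d e
    joined-without x x≢c d≢x e≢x with x ≟ a | x ≟ b
    ... | yes refl | _ = avoid-degree-two Γa⊆cd e≢x (connK-c d e (≢-sym c≢d) (≢-sym c≢e))
    ... | no _ | yes refl = reverse (avoid-degree-two Γb⊆ce d≢x (connK-c e d (≢-sym c≢e) (≢-sym c≢d)))
    ... | no x≢a | no x≢b = path _ d≢x (≢-sym x≢a) (≢-sym x≢c) (≢-sym x≢b) e≢x
    connK-x : ∀ x → ConnectedWithout K x
    connK-x x with x ≟ c
    ... | yes refl = connK-c
    ... | no x≢c = reroute-connected B⊆K+de (joined-without x x≢c) (connB-x x)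

  module Exchange (connF-c : ConnectedWithout F c) {H : Graph n}
                  (H⊆G : SpanningSubgraph H G) (tcH : TwoConnected H) where

    Hᵒ : Graph n
    Hᵒ = H -edge d , e

    Hᵒ⊆F : SpanningSubgraph Hᵒ F
    Hᵒ⊆F u v uv with deleted-edge H uv
    ... | uv∈H , ¬de = kept-edge G (H⊆G u v uv∈H) ¬de

    improve-by : ∀ {H'} → SpanningSubgraph Hᵒ H' → SpanningSubgraph H' F →
      Walk H' (λ v → v ≢ c) d e → edgeCount H' ≤ edgeCount H → Improvement F H
    improve-by {H'} Hᵒ⊆H' H'⊆F W ∣H'∣≤∣H∣ =
      H' , H'⊆F , twoConnected-transfer tcH H⊆H'+de gH' connH'-c , ∣H'∣≤∣H∣
      where
      H⊆H'+de : AllEdgesBut d e H H'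
      H⊆H'+de = allBut-⊆ {d = d} {e} {H} {Hᵒ} {H'} (-edge-allBut H d e) Hᵒ⊆H'
      gH' : Gadget H'
      gH' = gadget-plus (gadget-minus (gadget-forced H⊆G tcH)) Hᵒ⊆H'
                        λ u v uv → -edge-⊆ G d e u v (H'⊆F u v uv)
      connH'-c : ConnectedWithout H' c
      connH'-c = reroute-connected H⊆H'+de (λ _ _ → W) (proj₂ (proj₂ tcH) c)

    Reach : Fin n → Set
    Reach y = Walk Hᵒ (λ v → v ≢ c) d y

    -- If e ∉ Reach, a walk from d to e in F - c leaves Reach along an edge
    -- {u , v}; trading {d , e} for {u , v} joins d to e again, since in H - c
    -- the vertex v reaches e without passing d.
    exchange-across : adj H d e ≡ true → ¬ Reach e → Improvement F H
    exchange-across de∈H ¬Reach-e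
      with exit-edge Reach (walk? Hᵒ (λ v → ¬? (v ≟ c)) d) (connF-c d e (≢-sym c≢d) (≢-sym c≢e))
                     (stay (≢-sym c≢d)) ¬Reach-e
    ... | u , v , u≢c , v≢c , uv∈F , Reach-u , ¬Reach-v =
      improve-by (+edge-⊇ Hᵒ u≢v) H'⊆F (lift Reach-u ++ʷ step u≢c (+edge-new Hᵒ u≢v) v-to-e)
                 (edgeCount-exchange H de∈H d≢e u≢v)
      where
      u≢v : u ≢ v
      u≢v refl = true≢false (trans (≡-sym uv∈F) (irrefl F u))
      H' : Graph n
      H' = Hᵒ +edge u , v [ u≢v ]
      H'⊆F : SpanningSubgraph H' F
      H'⊆F x y xy with +edge-edges Hᵒ u≢v xy
      ... | inj₁ xy∈Hᵒ = Hᵒ⊆F x y xy∈Hᵒ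
      ... | inj₂ p = pair-edge F uv∈F p
      lift : ∀ {x y} → Walk Hᵒ (λ z → z ≢ c) x y → Walk H' (λ z → z ≢ c) x y
      lift = map-walk id (+edge-⊇ Hᵒ u≢v)
      v-to-e : Walk H' (λ z → z ≢ c) v e
      v-to-e with until-edge d e (proj₂ (proj₂ tcH) c v e v≢c (≢-sym c≢e))
      ... | inj₁ W = lift W
      ... | inj₂ (inj₁ W) = ⊥-elim (¬Reach-v (reverse W))
      ... | inj₂ (inj₂ W) = lift W

    improvement : Improvement F H
    improvement with adj H d e in de∈H
    ... | false = H , H⊆F , tcH , ℕP.≤-refl
      where
      H⊆F : SpanningSubgraph H F
      H⊆F u v uv = kept-edge G (H⊆G u v uv) λ p →
        true≢false (trans (≡-sym (pair-edge H uv (IsPair-sym p))) de∈H)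
    ... | true with walk? Hᵒ (λ v → ¬? (v ≟ c)) d e
    ...   | yes W = improve-by (⊆-refl Hᵒ) Hᵒ⊆F W (edgeCount-mono {K = Hᵒ} {K' = H} (-edge-⊆ H d e))
    ...   | no ¬W = exchange-across de∈H ¬W

mainTheorem2 : ∀ {n : ℕ} (G : Graph n) (a b c d e : Fin n) →
    TwoConnected G →
    a ≢ b → a ≢ c → a ≢ d → a ≢ e → b ≢ c → b ≢ d → b ≢ e → c ≢ d → c ≢ e → d ≢ e →
    (∀ (v : Fin n) → (adj G a v ≡ true) ⇔ (v ≡ c ⊎ v ≡ d)) →
    (∀ (v : Fin n) → (adj G b v ≡ true) ⇔ (v ≡ c ⊎ v ≡ e)) →
    adj G d e ≡ true →
    Redundant G d e ⇔ ConnectedWithout (G -edge d , e) c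
mainTheorem2 G a b c d e tcG a≢b a≢c a≢d a≢e b≢c b≢d b≢e c≢d c≢e d≢e Γa Γb _ =
  mk⇔ necessary sufficient
  where
  open Configuration G a b c d e a≢b a≢c a≢d a≢e b≢c b≢d b≢e c≢d c≢e d≢e Γa Γb
  necessary : Redundant G d e → ConnectedWithout F c
  necessary (tcF , _) = proj₂ (proj₂ tcF) c
  sufficient : ConnectedWithout F c → Redundant G d e
  sufficient connF-c with optimum-exists G tcG
  ... | k , optG =
    twoConnected-transfer tcG (-edge-allBut G d e) (gadget-minus gadget-G) connF-c , k , optG ,
    optimum-transfer {F = F} {G} (-edge-⊆ G d e) (λ H H⊆G tcH → Exchange.improvement connF-c {H} H⊆G tcH) optG
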